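{- Let $C_1(x,y,z)=x^2+y^2+z^2-1-2xyz$. Call a move on a triple $(v_1,v_2,v_3)$ the replacement of one coordinate by the other root of $C_1$ regarded as a quadratic in that coordinate with the other two coordinates fixed, i.e. one of $(v_1,v_2,v_3)\mapsto(2v_2v_3-v_1,v_2,v_3)$, $(v_1,2v_1v_3-v_2,v_3)$, $(v_1,v_2,2v_1v_2-v_3)$. Then for every positive integer solution $(a,b,c)$ of $C_1(a,b,c)=0$ there is a finite sequence of moves, passing only through positive integer solutions of $C_1=0$, which transforms $(a,b,c)$ into a triple that is a permutation of $(x,x,1)$ for some positive integer $x$.
   Context: A solution which is a permutation of $(x,x,1)$ is called a singular solution. Moves send solutions of $C_1=0$ to solutions of $C_1=0$. -}

module Defs where

open import Data.Integer using (ℤ; _+_; _*_; _-_; _<_; +_)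
open import Data.Product using (_×_; _,_; ∃-syntax)
open import Data.Sum using (_⊎_)
open import Relation.Binary.PropositionalEquality using (_≡_)

Triple : Set
Triple = ℤ × ℤ × ℤ

C₁ : ℤ → ℤ → ℤ → ℤ
C₁ x y z = x * x + y * y + z * z - + 1 - + 2 * x * y * z

IsSolution : Triple → Set
IsSolution (x , y , z) = C₁ x y z ≡ + 0

IsPositive : Triple → Set
IsPositive (x , y , z) = (+ 0 < x) × (+ 0 < y) × (+ 0 < z)

PosSolution : Triple → Set
PosSolution t = IsSolution t × IsPositive t

data Move : Triple → Triple → Set where
  move₁ : ∀ v₁ v₂ v₃ → Move (v₁ , v₂ , v₃) (+ 2 * v₂ * v₃ - v₁ , v₂ , v₃)
  move₂ : ∀ v₁ v₂ v₃ → Move (v₁ , v₂ , v₃) (v₁ , + 2 * v₁ * v₃ - v₂ , v₃)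
  move₃ : ∀ v₁ v₂ v₃ → Move (v₁ , v₂ , v₃) (v₁ , v₂ , + 2 * v₁ * v₂ - v₃)

data PosPath : Triple → Triple → Set where
  done : ∀ {t} → PosSolution t → PosPath t t
  step : ∀ {s t u} → PosSolution s → Move s t → PosPath t u → PosPath s u

IsPermOf-xx1 : ℤ → Triple → Set
IsPermOf-xx1 x t = (t ≡ (x , x , + 1)) ⊎ (t ≡ (x , + 1 , x)) ⊎ (t ≡ (+ 1 , x , x))

Singular : Triple → Set
Singular t = ∃[ x ] ((+ 0 < x) × IsPermOf-xx1 x t)

-- Vieta jumping.  For fixed x, y the equation C₁(x,y,z) = 0 is a monic quadratic in z whose roots
-- z and z' = 2xy − z satisfy (w − z)(w − z') = w² − 2xyw + x² + y² − 1.  For 1 < x ≤ y ≤ z the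
-- right side is positive at w = 0, so z' > 0, and equals (x − 1)(x + 1 − 2y²) < 0 at w = y, so
-- z' < y ≤ z.  Hence while no coordinate is 1, replacing the largest coordinate by the other root
-- is a move to a positive solution with a smaller coordinate sum; and once a coordinate is 1 the
-- solution is singular, since C₁(1,y,z) = (y − z)².
module Submission where

open import Defs
open import Data.Integer using (ℤ; _<_; +_)
open import Data.Product using (_×_; _,_; ∃-syntax)

open import Data.Nat using (zero; suc; z≤n; s≤s)
open import Data.Integer using (_+_; _*_; _-_; -_; _≤_; +<+; -<+; ∣_∣; _≟_)
open import Data.Integer.Properties
  using (≤-reflexive; ≤-trans; <-trans; <-≤-trans; ≤-total; <⇒≤; <⇒≱; ≮⇒≥; ≤∧≢⇒<; _<?_; i<j⇒suc[i]≤j; i<j⇒i≤pred[j];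
         i≤j⇒0≤j-i; i≤j⇒i-j≤0; i-j≡0⇒i≡j; i*j≡0⇒i≡0∨j≡0; *-zeroʳ; *-cancelˡ-<-nonNeg;
         +-identityʳ; +-mono-<; +-mono-≤-<; +-monoˡ-<; +-monoʳ-<; *-monoʳ-≤-nonNeg; neg-mono-<;
         0≤i⇒+∣i∣≡i)
open import Data.Integer.Base using (nonNegative)
open import Data.Integer.Solver using (module +-*-Solver)
open import Data.Sum using (_⊎_; inj₁; inj₂)
open import Function using (_∘_)
open import Relation.Nullary using (yes; no; contradiction)
open import Relation.Binary.PropositionalEquality using (_≡_; refl; sym; trans; subst; module ≡-Reasoning)

open +-*-Solver using (Polynomial; con; _:+_; _:-_; _:*_; _:=_; solve)

private
  variable
    x y z w : ℤ

0<1 : + 0 < + 1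
0<1 = +<+ (s≤s z≤n)

0<i∧0<j⇒0<i*j : + 0 < x → + 0 < y → + 0 < x * y
0<i∧0<j⇒0<i*j (+<+ (s≤s _)) (+<+ (s≤s _)) = +<+ (s≤s z≤n)

0<i∧j<0⇒i*j<0 : + 0 < x → y < + 0 → x * y < + 0
0<i∧j<0⇒i*j<0 (+<+ (s≤s _)) -<+ = -<+

0≤i∧0≤j⇒0≤i*j : + 0 ≤ x → + 0 ≤ y → + 0 ≤ x * y
0≤i∧0≤j⇒0≤i*j {y = y} 0≤x 0≤y = *-monoʳ-≤-nonNeg y {{nonNegative 0≤y}} 0≤x

0<i∧0<i*j⇒0<j : + 0 < x → + 0 < x * y → + 0 < y
0<i∧0<i*j⇒0<j {x} 0<x 0<xy =
  *-cancelˡ-<-nonNeg x {{nonNegative (<⇒≤ 0<x)}} (subst (_< x * _) (sym (*-zeroʳ x)) 0<xy)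

1<i⇒0<i-1 : + 1 < x → + 0 < x - + 1
1<i⇒0<i-1 = +-monoˡ-< (- + 1)

0<i⇒i≡1∨1<i : + 0 < x → x ≡ + 1 ⊎ + 1 < x
0<i⇒i≡1∨1<i {x} 0<x with x ≟ + 1
... | yes x≡1 = inj₁ x≡1
... | no x≢1 = inj₂ (≤∧≢⇒< (i<j⇒suc[i]≤j 0<x) (x≢1 ∘ sym))

-- (z − y)(w − y) is the value at y of the monic quadratic with roots z and w.
root-below : y ≤ z → (z - y) * (w - y) < + 0 → w < y
root-below {y} {z} {w} y≤z neg with w <? y
... | yes w<y = w<y
... | no w≮y = contradiction (0≤i∧0≤j⇒0≤i*j (i≤j⇒0≤j-i y≤z) (i≤j⇒0≤j-i (≮⇒≥ w≮y))) (<⇒≱ neg)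

otherRoot : ℤ → ℤ → ℤ → ℤ
otherRoot x y z = + 2 * x * y - z

-- C₁ and otherRoot as solver expressions: they evaluate definitionally to C₁ and otherRoot, so the
-- ring solver proves identities about them without unfolding.
C₁ₚ otherRootₚ : ∀ {n} → Polynomial n → Polynomial n → Polynomial n → Polynomial n
C₁ₚ x y z = x :* x :+ y :* y :+ z :* z :- con (+ 1) :- con (+ 2) :* x :* y :* z
otherRootₚ x y z = con (+ 2) :* x :* y :- z

C₁-rotate : ∀ x y z → C₁ x y z ≡ C₁ y z x
C₁-rotate = solve 3 (λ x y z → C₁ₚ x y z := C₁ₚ y z x) refl

C₁-swap : ∀ x y z → C₁ x y z ≡ C₁ y x z
C₁-swap = solve 3 (λ x y z → C₁ₚ x y z := C₁ₚ y x z) refl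

C₁-swap₂₃ : ∀ x y z → C₁ x y z ≡ C₁ x z y
C₁-swap₂₃ = solve 3 (λ x y z → C₁ₚ x y z := C₁ₚ x z y) refl

C₁-otherRoot : ∀ x y z → C₁ x y (otherRoot x y z) ≡ C₁ x y z
C₁-otherRoot = solve 3 (λ x y z → C₁ₚ x y (otherRootₚ x y z) := C₁ₚ x y z) refl

C₁-one : ∀ y z → C₁ (+ 1) y z ≡ (y - z) * (y - z)
C₁-one = solve 2 (λ y z → C₁ₚ (con (+ 1)) y z := (y :- z) :* (y :- z)) refl

otherRoot-comm : ∀ x y z → otherRoot x y z ≡ otherRoot y x z
otherRoot-comm = solve 3 (λ x y z → otherRootₚ x y z := otherRootₚ y x z) refl

-- The values at w = 0 and w = y of (w − z)(w − otherRoot x y z) = w² − 2xyw + x² + y² − 1 − C₁ x y z.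
otherRoot-product : ∀ x y z → z * otherRoot x y z ≡ (x - + 1) * (x + + 1) + y * y - C₁ x y z
otherRoot-product = solve 3 (λ x y z →
  z :* otherRootₚ x y z := (x :- con (+ 1)) :* (x :+ con (+ 1)) :+ y :* y :- C₁ₚ x y z) refl

otherRoot-shifted-product : ∀ x y z →
  (z - y) * (otherRoot x y z - y) ≡ (x - + 1) * ((x - y) - (+ 2 * y + + 1) * (y - + 1)) - C₁ x y z
otherRoot-shifted-product = solve 3 (λ x y z →
  (z :- y) :* (otherRootₚ x y z :- y)
    := (x :- con (+ 1)) :* ((x :- y) :- (con (+ 2) :* y :+ con (+ 1)) :* (y :- con (+ 1))) :- C₁ₚ x y z) refl

minus-zero : ∀ {a b} → b ≡ + 0 → a - b ≡ a
minus-zero {a} refl = +-identityʳ a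

C₁-one≡0⇒≡ : ∀ y z → C₁ (+ 1) y z ≡ + 0 → y ≡ z
C₁-one≡0⇒≡ y z C≡0 with i*j≡0⇒i≡0∨j≡0 (y - z) (trans (sym (C₁-one y z)) C≡0)
... | inj₁ y-z≡0 = i-j≡0⇒i≡j y z y-z≡0
... | inj₂ y-z≡0 = i-j≡0⇒i≡j y z y-z≡0

otherRoot-descends-sorted : + 1 < x → x ≤ y → y ≤ z → C₁ x y z ≡ + 0 →
                            + 0 < otherRoot x y z × otherRoot x y z < y
otherRoot-descends-sorted {x} {y} {z} 1<x x≤y y≤z C≡0 =
  0<i∧0<i*j⇒0<j 0<z (subst (+ 0 <_) (sym product) 0<product) ,
  root-below y≤z (subst (_< + 0) (sym shifted-product) shifted-product<0)
  where
  0<x-1 = 1<i⇒0<i-1 1<x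
  0<x = <-trans 0<1 1<x
  1<y = <-≤-trans 1<x x≤y
  0<y = <-≤-trans 0<x x≤y
  0<z = <-≤-trans 0<y y≤z

  product : z * otherRoot x y z ≡ (x - + 1) * (x + + 1) + y * y
  product = trans (otherRoot-product x y z) (minus-zero C≡0)

  0<product : + 0 < (x - + 1) * (x + + 1) + y * y
  0<product = +-mono-< (0<i∧0<j⇒0<i*j 0<x-1 (+-mono-< 0<x 0<1)) (0<i∧0<j⇒0<i*j 0<y 0<y)

  shifted-product : (z - y) * (otherRoot x y z - y) ≡ (x - + 1) * ((x - y) - (+ 2 * y + + 1) * (y - + 1))
  shifted-product = trans (otherRoot-shifted-product x y z) (minus-zero C≡0)

  shifted-product<0 : (x - + 1) * ((x - y) - (+ 2 * y + + 1) * (y - + 1)) < + 0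
  shifted-product<0 = 0<i∧j<0⇒i*j<0 0<x-1 (+-mono-≤-< (i≤j⇒i-j≤0 x≤y) (neg-mono-< 0<[2y+1][y-1]))
    where
    0<[2y+1][y-1] : + 0 < (+ 2 * y + + 1) * (y - + 1)
    0<[2y+1][y-1] = 0<i∧0<j⇒0<i*j (+-mono-< (0<i∧0<j⇒0<i*j {+ 2} (+<+ (s≤s z≤n)) 0<y) 0<1)
                                  (1<i⇒0<i-1 1<y)

otherRoot-descends : + 1 < x → + 1 < y → x ≤ z → y ≤ z → C₁ x y z ≡ + 0 →
                     + 0 < otherRoot x y z × otherRoot x y z < z
otherRoot-descends {x} {y} {z} 1<x 1<y x≤z y≤z C≡0 with ≤-total x y
... | inj₁ x≤y with otherRoot-descends-sorted 1<x x≤y y≤z C≡0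
...   | 0<w , w<y = 0<w , <-≤-trans w<y y≤z
otherRoot-descends {x} {y} {z} 1<x 1<y x≤z y≤z C≡0 | inj₂ y≤x
  with otherRoot-descends-sorted 1<y y≤x x≤z (trans (sym (C₁-swap x y z)) C≡0)
...   | 0<w , w<x rewrite otherRoot-comm x y z = 0<w , <-≤-trans w<x x≤z

Move-preserves-IsSolution : ∀ {s t} → Move s t → IsSolution s → IsSolution t
Move-preserves-IsSolution (move₁ x y z) C≡0 = begin
  C₁ (otherRoot y z x) y z ≡⟨ C₁-rotate (otherRoot y z x) y z ⟩
  C₁ y z (otherRoot y z x) ≡⟨ C₁-otherRoot y z x ⟩
  C₁ y z x                 ≡⟨ C₁-rotate x y z ⟨
  C₁ x y z                 ≡⟨ C≡0 ⟩
  + 0                      ∎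
  where open ≡-Reasoning
Move-preserves-IsSolution (move₂ x y z) C≡0 = begin
  C₁ x (otherRoot x z y) z ≡⟨ C₁-swap₂₃ x (otherRoot x z y) z ⟩
  C₁ x z (otherRoot x z y) ≡⟨ C₁-otherRoot x z y ⟩
  C₁ x z y                 ≡⟨ C₁-swap₂₃ x y z ⟨
  C₁ x y z                 ≡⟨ C≡0 ⟩
  + 0                      ∎
  where open ≡-Reasoning
Move-preserves-IsSolution (move₃ x y z) C≡0 = trans (C₁-otherRoot x y z) C≡0

coordinateSum : Triple → ℤ
coordinateSum (x , y , z) = x + y + z

DescendingMove : Triple → Set
DescendingMove s = ∃[ t ] (Move s t × PosSolution t × coordinateSum t < coordinateSum s)

ReachesSingular : Triple → Set
ReachesSingular s = ∃[ t ] (PosPath s t × Singular t)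

descendingMove : PosSolution (x , y , z) → + 1 < x → + 1 < y → + 1 < z → DescendingMove (x , y , z)
descendingMove {x} {y} {z} (C≡0 , 0<x , 0<y , 0<z) 1<x 1<y 1<z =
  byLargest (≤-total x z) (≤-total y z) (≤-total x y)
  where
  flip₁ : y ≤ x → z ≤ x → DescendingMove (x , y , z)
  flip₁ y≤x z≤x with otherRoot-descends 1<y 1<z y≤x z≤x (trans (sym (C₁-rotate x y z)) C≡0)
  ... | 0<w , w<x = _ , move₁ x y z , (Move-preserves-IsSolution (move₁ x y z) C≡0 , 0<w , 0<y , 0<z) ,
                    +-monoˡ-< z (+-monoˡ-< y w<x)

  flip₂ : x ≤ y → z ≤ y → DescendingMove (x , y , z)
  flip₂ x≤y z≤y with otherRoot-descends 1<x 1<z x≤y z≤y (trans (sym (C₁-swap₂₃ x y z)) C≡0)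
  ... | 0<w , w<y = _ , move₂ x y z , (Move-preserves-IsSolution (move₂ x y z) C≡0 , 0<x , 0<w , 0<z) ,
                    +-monoˡ-< z (+-monoʳ-< x w<y)

  flip₃ : x ≤ z → y ≤ z → DescendingMove (x , y , z)
  flip₃ x≤z y≤z with otherRoot-descends 1<x 1<y x≤z y≤z C≡0
  ... | 0<w , w<z = _ , move₃ x y z , (Move-preserves-IsSolution (move₃ x y z) C≡0 , 0<x , 0<y , 0<w) ,
                    +-monoʳ-< (x + y) w<z

  byLargest : x ≤ z ⊎ z ≤ x → y ≤ z ⊎ z ≤ y → x ≤ y ⊎ y ≤ x → DescendingMove (x , y , z)
  byLargest (inj₁ x≤z) (inj₁ y≤z) _          = flip₃ x≤z y≤z
  byLargest (inj₁ x≤z) (inj₂ z≤y) _          = flip₂ (≤-trans x≤z z≤y) z≤y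
  byLargest (inj₂ z≤x) (inj₁ y≤z) _          = flip₁ (≤-trans y≤z z≤x) z≤x
  byLargest (inj₂ z≤x) (inj₂ z≤y) (inj₁ x≤y) = flip₂ x≤y z≤y
  byLargest (inj₂ z≤x) (inj₂ z≤y) (inj₂ y≤x) = flip₁ y≤x z≤x

singular⊎descendingMove : ∀ {s} → PosSolution s → Singular s ⊎ DescendingMove s
singular⊎descendingMove {x , y , z} (C≡0 , 0<x , 0<y , 0<z)
  with 0<i⇒i≡1∨1<i 0<x | 0<i⇒i≡1∨1<i 0<y | 0<i⇒i≡1∨1<i 0<z
... | inj₁ refl | _ | _ with C₁-one≡0⇒≡ y z C≡0
...   | refl = inj₁ (y , 0<y , inj₂ (inj₂ refl))
singular⊎descendingMove {x , y , z} (C≡0 , 0<x , 0<y , 0<z) | inj₂ _ | inj₁ refl | _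
  with C₁-one≡0⇒≡ x z (trans (sym (C₁-swap x (+ 1) z)) C≡0)
...   | refl = inj₁ (x , 0<x , inj₂ (inj₁ refl))
singular⊎descendingMove {x , y , z} (C≡0 , 0<x , 0<y , 0<z) | inj₂ _ | inj₂ _ | inj₁ refl
  with C₁-one≡0⇒≡ x y (trans (C₁-rotate (+ 1) x y) C≡0)
...   | refl = inj₁ (x , 0<x , inj₁ refl)
singular⊎descendingMove S | inj₂ 1<x | inj₂ 1<y | inj₂ 1<z = inj₂ (descendingMove S 1<x 1<y 1<z)

0<coordinateSum : ∀ {s} → IsPositive s → + 0 < coordinateSum s
0<coordinateSum (0<x , 0<y , 0<z) = +-mono-< (+-mono-< 0<x 0<y) 0<z

reachesSingular : ∀ n {s} → PosSolution s → coordinateSum s ≤ + n → ReachesSingular s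
reachesSingular zero (_ , positive) sum≤0 = contradiction sum≤0 (<⇒≱ (0<coordinateSum positive))
reachesSingular (suc n) S sum≤n+1 with singular⊎descendingMove S
... | inj₁ singular = _ , done S , singular
... | inj₂ (t , move , T , descends) with reachesSingular n T (i<j⇒i≤pred[j] (<-≤-trans descends sum≤n+1))
...   | u , path , singular = u , step S move path , singular

mainTheorem2 : ∀ (a b c : ℤ) → PosSolution (a , b , c) →
                 ∃[ t ] (PosPath (a , b , c) t × Singular t)
mainTheorem2 a b c S@(_ , positive) =
  reachesSingular ∣ a + b + c ∣ S (≤-reflexive (sym (0≤i⇒+∣i∣≡i (<⇒≤ (0<coordinateSum positive)))))
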